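{- Let $d=2k+1$ with $k\ge1$, let $X\subseteq\mathbb{Z}_{2d}$ (identified with a subset of $[2d]$) with $|X|=d$, and let $\mathcal{F}(X)=\{F\in\binom{[2d]}{d}: \sum_{i\in F}i\in X \pmod{2d}\}$. Then for every $A\in\binom{[2d]}{d}$ the projection $\mathcal{F}(X)|_A$ contains exactly one of $\emptyset$ and $A$ if and only if $X\cap(d-X)=\emptyset$ modulo $2d$, where $d-X=\{d-x:x\in X\}$.
   Context: $\mathcal{F}|_A=\{F\cap A:F\in\mathcal{F}\}$. Elements of $[2d]$ are regarded as residues modulo $2d$. -}

module Defs where

open import Data.Nat using (ℕ; zero; suc; _+_; _*_; NonZero)
open import Data.Nat.DivMod using (_mod_)
open import Data.Fin using (Fin; toℕ)
open import Data.Fin.Subset using (Subset; _∈_; _∉_; _∩_; ∣_∣; ⊥; Side; inside; outside)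
open import Data.Vec using (Vec; []; _∷_; lookup; tabulate; sum)
open import Data.Product using (Σ; _×_)
open import Data.Sum using (_⊎_)
open import Relation.Binary.PropositionalEquality using (_≡_)
open import Relation.Nullary using (¬_)

-- The ground set [2d] is modelled as Fin (2d) = {0,…,2d-1}, i.e. as the
-- residues modulo 2d (the element 2d of [2d] is the residue 0).

contrib : Side → ℕ → ℕ
contrib inside  m = m
contrib outside m = 0

sumSet : ∀ {n} → Subset n → ℕ
sumSet {n} F = sum (tabulate {n = n} (λ i → contrib (lookup F i) (toℕ i)))

inFam : (d : ℕ) .{{_ : NonZero (d + d)}} → Subset (d + d) → Subset (d + d) → Set
inFam d X F = (∣ F ∣ ≡ d) × ((sumSet F mod (d + d)) ∈ X)

inProj : (d : ℕ) .{{_ : NonZero (d + d)}} → Subset (d + d) → Subset (d + d) → Subset (d + d) → Set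
inProj d X A B = Σ (Subset (d + d)) (λ F → inFam d X F × ((F ∩ A) ≡ B))

exactlyOneOfEmptyAndA : (d : ℕ) .{{_ : NonZero (d + d)}} → Subset (d + d) → Subset (d + d) → Set
exactlyOneOfEmptyAndA d X A =
  (inProj d X A ⊥ × ¬ inProj d X A A) ⊎ (¬ inProj d X A ⊥ × inProj d X A A)

negShift : (d : ℕ) .{{_ : NonZero (d + d)}} → Fin (d + d) → Fin (d + d)
negShift d x = (d + ((d + d) Data.Nat.∸ toℕ x)) mod (d + d)

disjointFromDMinus : (d : ℕ) .{{_ : NonZero (d + d)}} → Subset (d + d) → Set
disjointFromDMinus d X = ∀ (x : Fin (d + d)) → x ∈ X → negShift d x ∉ X

{-# OPTIONS --safe #-}
-- Write Σ F for the sum of the elements of F. For |A| = d the only d-set F with F ∩ A = A is A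
-- itself, and the only one with F ∩ A = ∅ is the complement ∁ A. As Σ (∁ A) + Σ A is
-- 0 + 1 + ⋯ + (2d − 1) = d + (d − 1)·2d, we get Σ (∁ A) ≡ d − Σ A (mod 2d). So 𝓕(X)|_A contains
-- exactly one of ∅ and A iff exactly one of Σ A and d − Σ A lies in X. Every residue is Σ A for
-- some d-set A, so the left-hand side says that exactly one of x and d − x lies in X, for every x.
-- This forbids x, d − x ∈ X; conversely, if X ∩ (d − X) = ∅ then the d-sets X and d − X
-- partition ℤ_2d, so one of x and d − x lies in X.
module Submission where

open import Defs
open import Data.Nat using (ℕ; zero; suc; _+_; _*_; _∸_; _≤_; z≤n; s≤s; s≤s⁻¹; NonZero)
open import Data.Nat.Properties
  using (suc-injective; +-assoc; +-comm; +-suc; *-suc; +-cancelʳ-≡; *-cancelˡ-≡;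
         ≤-reflexive; ≤-trans; <⇒≤; <⇒≱; ≰⇒>; _≤?_; +-monoʳ-≤; m≤m*n; m∸n+n≡m; m+n∸n≡m;
         m+[n∸m]≡n; m≤n+o⇒m∸n≤o; +-commutativeSemigroup; +-0-commutativeMonoid)
open import Data.Nat.DivMod
  using (_%_; _mod_; m%n<n; m%n≤n; m%n%n≡m%n; %-distribˡ-+; [m+n]%n≡m%n; [m+kn]%n≡m%n; m<n⇒m%n≡m)
open import Data.Nat.Tactic.RingSolver using (solve-∀)
open import Data.Bool using (not)
open import Data.Fin using (Fin; zero; suc; toℕ)
open import Data.Fin.Properties using (toℕ-fromℕ<; toℕ-injective; toℕ<n)
open import Data.Fin.Subset using (Subset; _∈_; _∉_; _⊆_; _∩_; ∁; ⊥; ⊤; ∣_∣; inside; outside)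
open import Data.Fin.Subset.Properties
  using (drop-∷-⊆; p⊆q⇒∣p∣≤∣q∣; x∈p∩q⁺; x∈p∩q⁻; ∉⊥; x∉p⇒x∈∁p; ∣∁p∣≡n∸∣p∣; ∣p∣≤n;
         ∣⊥∣≡0; ∣⊤∣≡n; ∩-idem; ∩-inverseˡ; _∈?_)
open import Data.Fin.Permutation using (Permutation; Permutation′; _⟨$⟩ʳ_; permutation)
open import Data.Vec using ([]; _∷_; here; lookup; tabulate; sum)
open import Data.Vec.Properties using (lookup∘tabulate; lookup⇒[]=; []=⇒lookup)
open import Data.Product using (_×_; _,_; proj₁; ∃-syntax)
open import Data.Product.Function.NonDependent.Propositional using (_×-⇔_)
open import Data.Sum using (_⊎_; inj₁; inj₂)
open import Data.Sum.Function.Propositional using (_⊎-⇔_)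
open import Data.Empty using (⊥-elim)
open import Function using (_∘_; _⇔_; mk⇔; Equivalence)
open import Function.Related.TypeIsomorphisms using (¬-cong-⇔)
open import Relation.Binary.PropositionalEquality
open import Relation.Nullary using (yes; no; contradiction)
open import Algebra.Properties.CommutativeSemigroup +-commutativeSemigroup using (x∙yz≈y∙xz; interchange)
import Algebra.Properties.CommutativeMonoid.Sum as CommutativeMonoidSum

open ≡-Reasoning
module ∑ = CommutativeMonoidSum +-0-commutativeMonoid

p⊆q∧∣q∣≤∣p∣⇒p≡q : ∀ {n} {p q : Subset n} → p ⊆ q → ∣ q ∣ ≤ ∣ p ∣ → p ≡ q
p⊆q∧∣q∣≤∣p∣⇒p≡q {p = []}          {[]}          _   _  = refl
p⊆q∧∣q∣≤∣p∣⇒p≡q {p = outside ∷ p} {outside ∷ q} p⊆q le =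
  cong (outside ∷_) (p⊆q∧∣q∣≤∣p∣⇒p≡q (drop-∷-⊆ p⊆q) le)
p⊆q∧∣q∣≤∣p∣⇒p≡q {p = outside ∷ p} {inside  ∷ q} p⊆q le = ⊥-elim (<⇒≱ le (p⊆q⇒∣p∣≤∣q∣ (drop-∷-⊆ p⊆q)))
p⊆q∧∣q∣≤∣p∣⇒p≡q {p = inside  ∷ p} {outside ∷ q} p⊆q le = contradiction (p⊆q here) λ ()
p⊆q∧∣q∣≤∣p∣⇒p≡q {p = inside  ∷ p} {inside  ∷ q} p⊆q le =
  cong (inside ∷_) (p⊆q∧∣q∣≤∣p∣⇒p≡q (drop-∷-⊆ p⊆q) (s≤s⁻¹ le))

p∩q≡q⇒q⊆p : ∀ {n} {p q : Subset n} → p ∩ q ≡ q → q ⊆ p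
p∩q≡q⇒q⊆p {p = p} {q} p∩q≡q x∈q = proj₁ (x∈p∩q⁻ p q (subst (_ ∈_) (sym p∩q≡q) x∈q))

p∩q≡⊥⇒p⊆∁q : ∀ {n} {p q : Subset n} → p ∩ q ≡ ⊥ → p ⊆ ∁ q
p∩q≡⊥⇒p⊆∁q p∩q≡⊥ {x} x∈p = x∉p⇒x∈∁p λ x∈q → ∉⊥ (subst (x ∈_) p∩q≡⊥ (x∈p∩q⁺ (x∈p , x∈q)))

∣∁p∣+∣p∣≡n : ∀ {n} (p : Subset n) → ∣ ∁ p ∣ + ∣ p ∣ ≡ n
∣∁p∣+∣p∣≡n p = trans (cong (_+ ∣ p ∣) (∣∁p∣≡n∸∣p∣ p)) (m∸n+n≡m (∣p∣≤n p))

preimage : ∀ {m n} → (Fin m → Fin n) → Subset n → Subset m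
preimage σ p = tabulate (λ i → lookup p (σ i))

∈-preimage⁻ : ∀ {m n} {σ : Fin m → Fin n} {p x} → x ∈ preimage σ p → σ x ∈ p
∈-preimage⁻ {σ = σ} {p} {x} x∈σ⁻¹p =
  lookup⇒[]= (σ x) p (trans (sym (lookup∘tabulate _ x)) ([]=⇒lookup x∈σ⁻¹p))

∣p∣≡∑contrib : ∀ {n} (p : Subset n) → ∣ p ∣ ≡ ∑.sum (λ i → contrib (lookup p i) 1)
∣p∣≡∑contrib []            = refl
∣p∣≡∑contrib (inside  ∷ p) = cong suc (∣p∣≡∑contrib p)
∣p∣≡∑contrib (outside ∷ p) = ∣p∣≡∑contrib p

∣preimage∣≡∣p∣ : ∀ {m n} (π : Permutation m n) (p : Subset n) → ∣ preimage (π ⟨$⟩ʳ_) p ∣ ≡ ∣ p ∣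
∣preimage∣≡∣p∣ {m} π p = begin
  ∣ π⁻¹p ∣                                         ≡⟨ ∣p∣≡∑contrib π⁻¹p ⟩
  ∑.sum (λ i → contrib (lookup π⁻¹p i) 1)          ≡⟨ ∑.sum-cong-≗ {m} (cong (λ s → contrib s 1) ∘ lookup∘tabulate _) ⟩
  ∑.sum (λ i → contrib (lookup p (π ⟨$⟩ʳ i)) 1)    ≡⟨ ∑.sum-permute _ π ⟨
  ∑.sum (λ i → contrib (lookup p i) 1)             ≡⟨ ∣p∣≡∑contrib p ⟨
  ∣ p ∣                                            ∎
  where
  π⁻¹p : Subset m
  π⁻¹p = preimage (π ⟨$⟩ʳ_) p

sum-contrib-suc : ∀ {n} (p : Subset n) (f : Fin n → ℕ) →
                  sum (tabulate (λ i → contrib (lookup p i) (suc (f i))))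
                    ≡ ∣ p ∣ + sum (tabulate (λ i → contrib (lookup p i) (f i)))
sum-contrib-suc []            f = refl
sum-contrib-suc (outside ∷ p) f = sum-contrib-suc p (f ∘ suc)
sum-contrib-suc (inside  ∷ p) f = cong suc (begin
  f zero + sum (tabulate (λ i → contrib (lookup p i) (suc (f (suc i)))))
    ≡⟨ cong (f zero +_) (sum-contrib-suc p (f ∘ suc)) ⟩
  f zero + (∣ p ∣ + rest)
    ≡⟨ x∙yz≈y∙xz (f zero) ∣ p ∣ rest ⟩
  ∣ p ∣ + (f zero + rest) ∎)
  where
  rest : ℕ
  rest = sum (tabulate (λ i → contrib (lookup p i) (f (suc i))))

-- Prepending a bit shifts every element of p up by one.
sumSet-∷ : ∀ {n} s (p : Subset n) → sumSet (s ∷ p) ≡ ∣ p ∣ + sumSet p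
sumSet-∷ outside p = sum-contrib-suc p toℕ
sumSet-∷ inside  p = sum-contrib-suc p toℕ

sumSet-⊥ : ∀ n → sumSet (⊥ {n}) ≡ 0
sumSet-⊥ zero    = refl
sumSet-⊥ (suc n) = trans (sumSet-∷ outside (⊥ {n})) (cong₂ _+_ (∣⊥∣≡0 n) (sumSet-⊥ n))

sumSet-⊤-suc : ∀ n → sumSet (⊤ {suc n}) ≡ n + sumSet (⊤ {n})
sumSet-⊤-suc n = trans (sumSet-∷ inside (⊤ {n})) (cong (_+ sumSet (⊤ {n})) (∣⊤∣≡n n))

sumSet-∁ : ∀ {n} (p : Subset n) → sumSet (∁ p) + sumSet p ≡ sumSet (⊤ {n})
sumSet-∁ []          = refl
sumSet-∁ {suc n} (s ∷ p) = begin
  sumSet (∁ (s ∷ p)) + sumSet (s ∷ p)            ≡⟨ cong₂ _+_ (sumSet-∷ (not s) (∁ p)) (sumSet-∷ s p) ⟩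
  (∣ ∁ p ∣ + sumSet (∁ p)) + (∣ p ∣ + sumSet p)   ≡⟨ interchange (∣ ∁ p ∣) _ (∣ p ∣) _ ⟩
  (∣ ∁ p ∣ + ∣ p ∣) + (sumSet (∁ p) + sumSet p)   ≡⟨ cong₂ _+_ (∣∁p∣+∣p∣≡n p) (sumSet-∁ p) ⟩
  n + sumSet (⊤ {n})                              ≡⟨ sumSet-⊤-suc n ⟨
  sumSet (⊤ {suc n})                              ∎

sumSet-⊤ : ∀ n → 2 * sumSet (⊤ {n}) + n ≡ n * n
sumSet-⊤ zero    = refl
sumSet-⊤ (suc n) = begin
  2 * sumSet (⊤ {suc n}) + suc n          ≡⟨ cong (λ s → 2 * s + suc n) (sumSet-⊤-suc n) ⟩
  2 * (n + sumSet (⊤ {n})) + suc n        ≡⟨ regroup n (sumSet (⊤ {n})) ⟩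
  (2 * sumSet (⊤ {n}) + n) + suc (2 * n)  ≡⟨ cong (_+ suc (2 * n)) (sumSet-⊤ n) ⟩
  n * n + suc (2 * n)                     ≡⟨ square-suc n ⟩
  suc n * suc n                           ∎
  where
  regroup : ∀ n s → 2 * (n + s) + suc n ≡ (2 * s + n) + suc (2 * n)
  regroup = solve-∀
  square-suc : ∀ n → n * n + suc (2 * n) ≡ suc n * suc n
  square-suc = solve-∀

sumSet-⊤-double : ∀ m → let d = suc m in sumSet (⊤ {d + d}) ≡ d + m * (d + d)
sumSet-⊤-double m =
  *-cancelˡ-≡ _ _ 2 (+-cancelʳ-≡ (d + d) _ _ (trans (sumSet-⊤ (d + d)) (sym (double m))))
  where
  d : ℕ
  d = suc m
  double : ∀ n → 2 * (suc n + n * (suc n + suc n)) + (suc n + suc n) ≡ (suc n + suc n) * (suc n + suc n)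
  double = solve-∀

-- The sums of the j-subsets of {0, …, j + m − 1} fill the interval from 0 + ⋯ + (j − 1) to
-- m + ⋯ + (m + j − 1); the recursion decides whether 0 ∈ p.
subset-with-sum : ∀ {n} j m e → j + m ≡ n → e ≤ j * m →
                  ∃[ p ] ∣ p ∣ ≡ j × sumSet {n} p ≡ sumSet (⊤ {j}) + e
subset-with-sum zero m zero    refl _ = ⊥ , ∣⊥∣≡0 m , sumSet-⊥ m
subset-with-sum zero m (suc e) _    ()
subset-with-sum {zero}  (suc j) m e () _
subset-with-sum {suc n} (suc j) m e eq _ with e ≤? j * m
... | yes e≤jm =
  let p , ∣p∣≡j , Σp≡ = subset-with-sum j m e (suc-injective eq) e≤jm in
  inside ∷ p , cong suc ∣p∣≡j , (begin
    sumSet (inside ∷ p)             ≡⟨ sumSet-∷ inside p ⟩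
    ∣ p ∣ + sumSet p                ≡⟨ cong₂ _+_ ∣p∣≡j Σp≡ ⟩
    j + (sumSet (⊤ {j}) + e)        ≡⟨ +-assoc j _ e ⟨
    j + sumSet (⊤ {j}) + e          ≡⟨ cong (_+ e) (sumSet-⊤-suc j) ⟨
    sumSet (⊤ {suc j}) + e          ∎)
subset-with-sum {suc n} (suc j) zero    e eq e≤j0 | no e≰j0 = contradiction e≤j0 e≰j0
subset-with-sum {suc n} (suc j) (suc m) e eq e≤[1+j][1+m] | no e≰j[1+m] =
  let p , ∣p∣≡1+j , Σp≡ = subset-with-sum (suc j) m (e ∸ suc j) eq′ e∸[1+j]≤[1+j]m in
  outside ∷ p , ∣p∣≡1+j , (begin
    sumSet (outside ∷ p)                            ≡⟨ sumSet-∷ outside p ⟩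
    ∣ p ∣ + sumSet p                                ≡⟨ cong₂ _+_ ∣p∣≡1+j Σp≡ ⟩
    suc j + (sumSet (⊤ {suc j}) + (e ∸ suc j))      ≡⟨ x∙yz≈y∙xz (suc j) _ _ ⟩
    sumSet (⊤ {suc j}) + (suc j + (e ∸ suc j))      ≡⟨ cong (sumSet (⊤ {suc j}) +_) (m+[n∸m]≡n 1+j≤e) ⟩
    sumSet (⊤ {suc j}) + e                          ∎)
  where
  eq′ : suc j + m ≡ n
  eq′ = trans (sym (+-suc j m)) (suc-injective eq)
  e∸[1+j]≤[1+j]m : e ∸ suc j ≤ suc j * m
  e∸[1+j]≤[1+j]m = m≤n+o⇒m∸n≤o e (suc j) (subst (e ≤_) (*-suc (suc j) m) e≤[1+j][1+m])
  1+j≤e : suc j ≤ e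
  1+j≤e = ≤-trans (s≤s (m≤m*n j (suc m))) (≰⇒> e≰j[1+m])

n+n≤1+n*n : ∀ n → n + n ≤ suc (n * n)
n+n≤1+n*n zero    = z≤n
n+n≤1+n*n (suc m) = s≤s (≤-trans (≤-reflexive (+-suc m m)) (s≤s (+-monoʳ-≤ m (m≤m*n m (suc m)))))

toℕ-mod : ∀ a n .{{_ : NonZero n}} → toℕ (a mod n) ≡ a % n
toℕ-mod a n = toℕ-fromℕ< (m%n<n a n)

module Modular (N : ℕ) .{{_ : NonZero N}} where

  -- c − a modulo N; the truncated N ∸ a is exact because a ≤ N wherever it is used.
  _⊖_ : ℕ → ℕ → ℕ
  c ⊖ a = (c + (N ∸ a)) % N

  [m%N+n]%N≡[m+n]%N : ∀ m n → (m % N + n) % N ≡ (m + n) % N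
  [m%N+n]%N≡[m+n]%N m n = begin
    (m % N + n) % N          ≡⟨ %-distribˡ-+ (m % N) n N ⟩
    (m % N % N + n % N) % N  ≡⟨ cong (λ r → (r + n % N) % N) (m%n%n≡m%n m N) ⟩
    (m % N + n % N) % N      ≡⟨ %-distribˡ-+ m n N ⟨
    (m + n) % N              ∎

  [m+[N∸a]+a]%N≡m%N : ∀ m {a} → a ≤ N → (m + (N ∸ a) + a) % N ≡ m % N
  [m+[N∸a]+a]%N≡m%N m {a} a≤N = begin
    (m + (N ∸ a) + a) % N    ≡⟨ cong (_% N) (+-assoc m (N ∸ a) a) ⟩
    (m + (N ∸ a + a)) % N    ≡⟨ cong (λ r → (m + r) % N) (m∸n+n≡m a≤N) ⟩
    (m + N) % N              ≡⟨ [m+n]%n≡m%n m N ⟩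
    m % N                    ∎

  [a+[c⊖a]]%N≡c%N : ∀ {a} c → a ≤ N → (a + (c ⊖ a)) % N ≡ c % N
  [a+[c⊖a]]%N≡c%N {a} c a≤N = begin
    (a + (c + (N ∸ a)) % N) % N  ≡⟨ cong (_% N) (+-comm a _) ⟩
    ((c + (N ∸ a)) % N + a) % N  ≡⟨ [m%N+n]%N≡[m+n]%N (c + (N ∸ a)) a ⟩
    (c + (N ∸ a) + a) % N        ≡⟨ [m+[N∸a]+a]%N≡m%N c a≤N ⟩
    c % N                        ∎

  [a+b]%N≡c%N⇒b%N≡c⊖a : ∀ {a b c} → a ≤ N → (a + b) % N ≡ c % N → b % N ≡ c ⊖ a
  [a+b]%N≡c%N⇒b%N≡c⊖a {a} {b} {c} a≤N [a+b]≡c = begin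
    b % N                      ≡⟨ [m+[N∸a]+a]%N≡m%N b a≤N ⟨
    (b + (N ∸ a) + a) % N      ≡⟨ cong (_% N) (+-comm (b + (N ∸ a)) a) ⟩
    (a + (b + (N ∸ a))) % N    ≡⟨ cong (_% N) (+-assoc a b (N ∸ a)) ⟨
    (a + b + (N ∸ a)) % N      ≡⟨ [m%N+n]%N≡[m+n]%N (a + b) (N ∸ a) ⟨
    ((a + b) % N + (N ∸ a)) % N ≡⟨ cong (λ r → (r + (N ∸ a)) % N) [a+b]≡c ⟩
    (c % N + (N ∸ a)) % N      ≡⟨ [m%N+n]%N≡[m+n]%N c (N ∸ a) ⟩
    c ⊖ a                      ∎

module _ (m : ℕ) where

  private
    d : ℕ
    d = suc m
    N : ℕ
    N = d + d

  open Modular N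

  ∣p∣≡d⇒∣∁p∣≡d : ∀ (p : Subset N) → ∣ p ∣ ≡ d → ∣ ∁ p ∣ ≡ d
  ∣p∣≡d⇒∣∁p∣≡d p ∣p∣≡d = trans (∣∁p∣≡n∸∣p∣ p) (trans (cong (N ∸_) ∣p∣≡d) (m+n∸n≡m d d))

  toℕ-negShift : ∀ x → toℕ (negShift d x) ≡ d ⊖ toℕ x
  toℕ-negShift x = toℕ-mod (d + (N ∸ toℕ x)) N

  negShift-involutive : ∀ x → negShift d (negShift d x) ≡ x
  negShift-involutive x = toℕ-injective (begin
    toℕ (negShift d (negShift d x))  ≡⟨ toℕ-negShift (negShift d x) ⟩
    d ⊖ toℕ (negShift d x)           ≡⟨ [a+b]%N≡c%N⇒b%N≡c⊖a {c = d} (<⇒≤ (toℕ<n (negShift d x))) [y+x]%N≡d%N ⟨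
    toℕ x % N                        ≡⟨ m<n⇒m%n≡m (toℕ<n x) ⟩
    toℕ x                            ∎)
    where
    [y+x]%N≡d%N : (toℕ (negShift d x) + toℕ x) % N ≡ d % N
    [y+x]%N≡d%N = begin
      (toℕ (negShift d x) + toℕ x) % N  ≡⟨ cong (_% N) (+-comm _ (toℕ x)) ⟩
      (toℕ x + toℕ (negShift d x)) % N  ≡⟨ cong (λ r → (toℕ x + r) % N) (toℕ-negShift x) ⟩
      (toℕ x + (d ⊖ toℕ x)) % N         ≡⟨ [a+[c⊖a]]%N≡c%N d (<⇒≤ (toℕ<n x)) ⟩
      d % N                             ∎

  sumSet-∁-mod : ∀ (A : Subset N) → sumSet (∁ A) mod N ≡ negShift d (sumSet A mod N)
  sumSet-∁-mod A = toℕ-injective (begin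
    toℕ (sumSet (∁ A) mod N)          ≡⟨ toℕ-mod (sumSet (∁ A)) N ⟩
    sumSet (∁ A) % N                  ≡⟨ [a+b]%N≡c%N⇒b%N≡c⊖a {c = d} (m%n≤n (sumSet A) N) [ΣA%N+Σ∁A]%N≡d%N ⟩
    d ⊖ (sumSet A % N)                ≡⟨ cong (d ⊖_) (toℕ-mod (sumSet A) N) ⟨
    d ⊖ toℕ (sumSet A mod N)          ≡⟨ toℕ-negShift (sumSet A mod N) ⟨
    toℕ (negShift d (sumSet A mod N)) ∎)
    where
    [ΣA%N+Σ∁A]%N≡d%N : (sumSet A % N + sumSet (∁ A)) % N ≡ d % N
    [ΣA%N+Σ∁A]%N≡d%N = begin
      (sumSet A % N + sumSet (∁ A)) % N  ≡⟨ [m%N+n]%N≡[m+n]%N (sumSet A) (sumSet (∁ A)) ⟩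
      (sumSet A + sumSet (∁ A)) % N      ≡⟨ cong (_% N) (trans (+-comm (sumSet A) _) (sumSet-∁ A)) ⟩
      sumSet (⊤ {N}) % N                 ≡⟨ cong (_% N) (sumSet-⊤-double m) ⟩
      (d + m * N) % N                    ≡⟨ [m+kn]%n≡m%n d m N ⟩
      d % N                              ∎

  sumSet-mod-surjective : ∀ (r : Fin N) → ∃[ A ] ∣ A ∣ ≡ d × sumSet A mod N ≡ r
  sumSet-mod-surjective r =
    let A , ∣A∣≡d , ΣA≡T+e = subset-with-sum d d e refl e≤d*d in
    A , ∣A∣≡d , toℕ-injective (begin
      toℕ (sumSet A mod N)  ≡⟨ toℕ-mod (sumSet A) N ⟩
      sumSet A % N          ≡⟨ cong (_% N) ΣA≡T+e ⟩
      (T + e) % N           ≡⟨ [m%N+n]%N≡[m+n]%N T e ⟨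
      (T % N + e) % N       ≡⟨ [a+[c⊖a]]%N≡c%N (toℕ r) (m%n≤n T N) ⟩
      toℕ r % N             ≡⟨ m<n⇒m%n≡m (toℕ<n r) ⟩
      toℕ r                 ∎)
    where
    T : ℕ
    T = sumSet (⊤ {d})
    e : ℕ
    e = toℕ r ⊖ (T % N)
    e≤d*d : e ≤ d * d
    e≤d*d = s≤s⁻¹ (≤-trans (m%n<n (toℕ r + (N ∸ T % N)) N) (n+n≤1+n*n d))

  module _ (X : Subset N) {A : Subset N} (∣A∣≡d : ∣ A ∣ ≡ d) where

    A∈𝓕|A⇔ : inProj d X A A ⇔ sumSet A mod N ∈ X
    A∈𝓕|A⇔ = mk⇔ to (λ ΣA∈X → A , (∣A∣≡d , ΣA∈X) , ∩-idem A)
      where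
      to : inProj d X A A → sumSet A mod N ∈ X
      to (F , (∣F∣≡d , ΣF∈X) , F∩A≡A) = subst (λ G → sumSet G mod N ∈ X) (sym A≡F) ΣF∈X
        where
        A≡F : A ≡ F
        A≡F = p⊆q∧∣q∣≤∣p∣⇒p≡q (p∩q≡q⇒q⊆p F∩A≡A) (≤-reflexive (trans ∣F∣≡d (sym ∣A∣≡d)))

    ∅∈𝓕|A⇔ : inProj d X A ⊥ ⇔ negShift d (sumSet A mod N) ∈ X
    ∅∈𝓕|A⇔ = mk⇔ to from
      where
      to : inProj d X A ⊥ → negShift d (sumSet A mod N) ∈ X
      to (F , (∣F∣≡d , ΣF∈X) , F∩A≡⊥) =
        subst (_∈ X) (sumSet-∁-mod A) (subst (λ G → sumSet G mod N ∈ X) F≡∁A ΣF∈X)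
        where
        F≡∁A : F ≡ ∁ A
        F≡∁A = p⊆q∧∣q∣≤∣p∣⇒p≡q (p∩q≡⊥⇒p⊆∁q F∩A≡⊥)
                 (≤-reflexive (trans (∣p∣≡d⇒∣∁p∣≡d A ∣A∣≡d) (sym ∣F∣≡d)))
      from : negShift d (sumSet A mod N) ∈ X → inProj d X A ⊥
      from Σ∁A∈X =
        ∁ A , (∣p∣≡d⇒∣∁p∣≡d A ∣A∣≡d , subst (_∈ X) (sym (sumSet-∁-mod A)) Σ∁A∈X) , ∩-inverseˡ A

    exactlyOne⇔ : exactlyOneOfEmptyAndA d X A
                    ⇔ ((negShift d (sumSet A mod N) ∈ X × sumSet A mod N ∉ X)
                      ⊎ (negShift d (sumSet A mod N) ∉ X × sumSet A mod N ∈ X))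
    exactlyOne⇔ = (∅∈𝓕|A⇔ ×-⇔ ¬-cong-⇔ A∈𝓕|A⇔) ⊎-⇔ (¬-cong-⇔ ∅∈𝓕|A⇔ ×-⇔ A∈𝓕|A⇔)

  exactlyOne⇒disjoint : (X : Subset N) → ((A : Subset N) → ∣ A ∣ ≡ d → exactlyOneOfEmptyAndA d X A) →
                        disjointFromDMinus d X
  exactlyOne⇒disjoint X exactlyOne x x∈X d-x∈X with sumSet-mod-surjective x
  ... | A , ∣A∣≡d , refl with Equivalence.to (exactlyOne⇔ X ∣A∣≡d) (exactlyOne A ∣A∣≡d)
  ...   | inj₁ (_ , x∉X)   = x∉X x∈X
  ...   | inj₂ (d-x∉X , _) = d-x∉X d-x∈X

  disjoint⇒covers : (X : Subset N) → ∣ X ∣ ≡ d → disjointFromDMinus d X → ∀ x → x ∉ X → negShift d x ∈ X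
  disjoint⇒covers X ∣X∣≡d disjoint x x∉X =
    ∈-preimage⁻ {σ = negShift d} (subst (x ∈_) (sym d-X≡∁X) (x∉p⇒x∈∁p x∉X))
    where
    reflection : Permutation′ N
    reflection = permutation (negShift d) (negShift d) negShift-involutive negShift-involutive
    d-X : Subset N
    d-X = preimage (negShift d) X
    d-X⊆∁X : d-X ⊆ ∁ X
    d-X⊆∁X {y} y∈d-X =
      x∉p⇒x∈∁p (subst (_∉ X) (negShift-involutive y) (disjoint _ (∈-preimage⁻ {σ = negShift d} y∈d-X)))
    d-X≡∁X : d-X ≡ ∁ X
    d-X≡∁X = p⊆q∧∣q∣≤∣p∣⇒p≡q d-X⊆∁X (≤-reflexive (begin
      ∣ ∁ X ∣   ≡⟨ ∣p∣≡d⇒∣∁p∣≡d X ∣X∣≡d ⟩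
      d         ≡⟨ ∣X∣≡d ⟨
      ∣ X ∣     ≡⟨ ∣preimage∣≡∣p∣ reflection X ⟨
      ∣ d-X ∣   ∎))

  disjoint⇒exactlyOne : (X : Subset N) → ∣ X ∣ ≡ d → disjointFromDMinus d X →
                        (A : Subset N) → ∣ A ∣ ≡ d → exactlyOneOfEmptyAndA d X A
  disjoint⇒exactlyOne X ∣X∣≡d disjoint A ∣A∣≡d = Equivalence.from (exactlyOne⇔ X ∣A∣≡d) exactlyOne
    where
    exactlyOne : (negShift d (sumSet A mod N) ∈ X × sumSet A mod N ∉ X)
               ⊎ (negShift d (sumSet A mod N) ∉ X × sumSet A mod N ∈ X)
    exactlyOne with sumSet A mod N ∈? X
    ... | yes ΣA∈X = inj₂ (disjoint _ ΣA∈X , ΣA∈X)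
    ... | no  ΣA∉X = inj₁ (disjoint⇒covers X ∣X∣≡d disjoint _ ΣA∉X , ΣA∉X)

lemma2 : (k : ℕ) → 1 ≤ k → (X : Subset (suc (2 * k) + suc (2 * k))) → ∣ X ∣ ≡ suc (2 * k) →
           (((A : Subset (suc (2 * k) + suc (2 * k))) → ∣ A ∣ ≡ suc (2 * k) → exactlyOneOfEmptyAndA (suc (2 * k)) X A)
             → disjointFromDMinus (suc (2 * k)) X)
           × (disjointFromDMinus (suc (2 * k)) X
             → (A : Subset (suc (2 * k) + suc (2 * k))) → ∣ A ∣ ≡ suc (2 * k) → exactlyOneOfEmptyAndA (suc (2 * k)) X A)
lemma2 k _ X ∣X∣≡d = exactlyOne⇒disjoint (2 * k) X , disjoint⇒exactlyOne (2 * k) X ∣X∣≡d
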